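{- There exist a database $D$ and a DatalogMTL program $\Pi$ that only uses temporal operators $\Diamond^-_{\langle t_1,t_2\rangle}$ with $t_2>t_1$ such that there is no time point $T\in\mathbb Q$ with the property that for every $t>T$ and every ground atom $\alpha$: $\alpha@t\in\Pi(D)$ iff $\alpha@T\in\Pi(D)$.
   Context: DatalogMTL over $\mathbb Q$ with continuous semantics. Rules are of the forms $P_1(\boldsymbol\tau_1)\land\dots\land P_n(\boldsymbol\tau_n)\to P_0(\boldsymbol\tau_0)$ and $\Diamond^-_\varrho P_1(\boldsymbol\tau_1)\to P_0(\boldsymbol\tau_0)$ with non-negative intervals $\varrho$, where $\mathfrak M,t\models\Diamond^-_\varrho A$ iff $\mathfrak M,s\models A$ for some $s$ with $t-s\in\varrho$. A database is a finite set of facts $A@\varrho$ ($A$ ground atom, $\varrho$ an interval). $\Pi(D)$ is the minimum model of $\Pi$ and $D$, and $\alpha@t\in\Pi(D)$ means $\alpha$ holds at time $t$ in it. -}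

module Defs where

open import Data.Nat using (ℕ)
open import Data.Rational using (ℚ; _<_; _≤_; _-_; 0ℚ)
open import Data.Bool using (Bool; true; false)
open import Data.List using (List; []; _∷_)
open import Data.List.Membership.Propositional using (_∈_)
open import Data.List.Relation.Unary.All using (All)
open import Data.List.Relation.Unary.Any using (Any)
open import Data.Product using (Σ; _×_; _,_)
open import Data.Sum using (_⊎_)
open import Data.Unit using (⊤)
open import Data.Empty using (⊥)
open import Relation.Binary.PropositionalEquality using (_≡_)

PredSym : Set
PredSym = ℕ

Const : Set
Const = ℕ

Var : Set
Var = ℕ

data Term : Set where
  const : Const → Term
  var   : Var → Term

record Atom : Set where
  constructor _⟨_⟩
  field
    pred : PredSym
    args : List Term

record GroundAtom : Set where
  constructor _⟪_⟫
  field
    gpred : PredSym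
    gargs : List Const

-- Interval endpoints: ±∞ or a rational q, with a flag saying whether the
-- endpoint is included (true = closed bracket).
data Bound : Set where
  -∞ +∞ : Bound
  fin   : ℚ → Bool → Bound

record Interval : Set where
  constructor ⟨_,_⟩
  field
    lower : Bound
    upper : Bound

AboveLower : Bound → ℚ → Set
AboveLower -∞ t = ⊤
AboveLower +∞ t = ⊥
AboveLower (fin q true) t = q ≤ t
AboveLower (fin q false) t = q < t

BelowUpper : Bound → ℚ → Set
BelowUpper -∞ t = ⊥
BelowUpper +∞ t = ⊤
BelowUpper (fin q true) t = t ≤ q
BelowUpper (fin q false) t = t < q

_∈ᵢ_ : ℚ → Interval → Set
t ∈ᵢ ⟨ l , u ⟩ = AboveLower l t × BelowUpper u t

-- Rules: P₁ ∧ … ∧ Pₙ → P₀ (n ≥ 1) and ◇⁻_ϱ P₁ → P₀.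
data Rule : Set where
  conj    : Atom → List Atom → Atom → Rule      -- first body atom, rest, head
  diamond : Interval → Atom → Atom → Rule       -- ϱ, body atom, head

Program : Set
Program = List Rule

record Fact : Set where
  constructor _at_
  field
    atom     : GroundAtom
    interval : Interval

Database : Set
Database = List Fact

Occurs : Var → Atom → Set
Occurs x (p ⟨ ts ⟩) = Any (λ τ → τ ≡ var x) ts

Safe : Rule → Set
Safe (conj b bs h) = ∀ x → Occurs x h → Any (Occurs x) (b ∷ bs)
Safe (diamond ϱ b h) = ∀ x → Occurs x h → Occurs x b

NonPunctualNonNeg : Interval → Set
NonPunctualNonNeg ⟨ fin t₁ _ , fin t₂ _ ⟩ = (0ℚ ≤ t₁) × (t₁ < t₂)
NonPunctualNonNeg ⟨ fin t₁ _ , +∞ ⟩       = 0ℚ ≤ t₁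
NonPunctualNonNeg _                       = ⊥

WellFormedRule : Rule → Set
WellFormedRule r@(conj _ _ _)    = Safe r
WellFormedRule r@(diamond ϱ _ _) = Safe r × NonPunctualNonNeg ϱ

Subst : Set
Subst = Var → Const

applyT : Subst → Term → Const
applyT σ (const c) = c
applyT σ (var x)   = σ x

ground : Subst → Atom → GroundAtom
ground σ (p ⟨ ts ⟩) = p ⟪ Data.List.map (applyT σ) ts ⟫

Interpretation : Set₁
Interpretation = GroundAtom → ℚ → Set

Sat◇ : Interpretation → Interval → GroundAtom → ℚ → Set
Sat◇ M ϱ α t = Σ ℚ λ s → ((t - s) ∈ᵢ ϱ) × M α s

SatRule : Interpretation → Rule → Set
SatRule M (conj b bs h) =
  ∀ (σ : Subst) (t : ℚ) → All (λ a → M (ground σ a) t) (b ∷ bs) → M (ground σ h) t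
SatRule M (diamond ϱ b h) =
  ∀ (σ : Subst) (t : ℚ) → Sat◇ M ϱ (ground σ b) t → M (ground σ h) t

ModelΠ : Interpretation → Program → Set
ModelΠ M Π = All (SatRule M) Π

ModelD : Interpretation → Database → Set
ModelD M D = All (λ f → ∀ t → t ∈ᵢ Fact.interval f → M (Fact.atom f) t) D

-- α@t ∈ Π(D): α holds at t in the minimum model of Π and D, i.e. in every
-- model of Π and D (the minimum model is the intersection of all models).
_at_∈⟦_,_⟧ : GroundAtom → ℚ → Program → Database → Set₁
α at t ∈⟦ Π , D ⟧ = ∀ (M : Interpretation) → ModelΠ M Π → ModelD M D → M α t

-- Take Π = { A ← ◇⁻[1,2] P,  B ← ◇⁻[2,3) P,  P ← A ∧ B } and D = { P@[0,0] }.
-- P propagates from t to t + 2 (2 is the only distance lying in both [1,2] and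
-- [2,3)), so P holds at every even natural number; conversely the
-- interpretation in which P holds exactly at the even naturals is a model, so
-- P fails at every odd natural number. Hence P keeps oscillating above any T.
module Submission where

open import Defs
open import Data.Rational using (ℚ; _<_)
open import Data.Product using (Σ; _×_)
open import Data.List.Relation.Unary.All using (All)
open import Relation.Nullary using (¬_)

open import Algebra.Properties.Group using (//-rightDividesˡ; //-rightDividesʳ)
open import Data.Bool using (true; false)
open import Data.Integer as ℤ using (+_; -[1+_]; +≤+; +<+; -≤+)
import Data.Integer.Properties as ℤ
open import Data.List using ([]; _∷_)
open import Data.List.Relation.Unary.All using ([]; _∷_)
open import Data.Nat as ℕ using (ℕ; zero; suc; z≤n; s≤s)
import Data.Nat.Properties as ℕ
open import Data.Product using (_,_; proj₁; proj₂)
open import Data.Rational using (mkℚ; 0ℚ; _+_; _-_; _≤_; *≤*; *<*)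
open import Data.Rational.Literals using (fromℤ)
import Data.Rational.Properties as ℚₚ
import Data.Rational.Unnormalised as ℚᵘ
import Data.Rational.Unnormalised.Properties as ℚᵘ
open import Data.Unit using (⊤)
open import Relation.Binary.PropositionalEquality

fromℕ : ℕ → ℚ
fromℕ n = fromℤ (+ n)

private
  n*1≡n : ∀ n → + n ℤ.* + 1 ≡ + n
  n*1≡n n = ℤ.*-identityʳ (+ n)

fromℕ-mono-≤ : ∀ {m n} → m ℕ.≤ n → fromℕ m ≤ fromℕ n
fromℕ-mono-≤ {m} {n} m≤n = *≤* (subst₂ ℤ._≤_ (sym (n*1≡n m)) (sym (n*1≡n n)) (+≤+ m≤n))

fromℕ-mono-< : ∀ {m n} → m ℕ.< n → fromℕ m < fromℕ n
fromℕ-mono-< {m} {n} m<n = *<* (subst₂ ℤ._<_ (sym (n*1≡n m)) (sym (n*1≡n n)) (+<+ m<n))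

fromℕ-cancel-≤ : ∀ {m n} → fromℕ m ≤ fromℕ n → m ℕ.≤ n
fromℕ-cancel-≤ {m} {n} (*≤* le) with subst₂ ℤ._≤_ (n*1≡n m) (n*1≡n n) le
... | +≤+ m≤n = m≤n

fromℕ-cancel-< : ∀ {m n} → fromℕ m < fromℕ n → m ℕ.< n
fromℕ-cancel-< {m} {n} (*<* lt) with subst₂ ℤ._<_ (n*1≡n m) (n*1≡n n) lt
... | +<+ m<n = m<n

fromℕ-injective : ∀ {m n} → fromℕ m ≡ fromℕ n → m ≡ n
fromℕ-injective eq = ℤ.+-injective (cong ℚ.numerator eq)

fromℕ-homo-+ : ∀ m n → fromℕ m + fromℕ n ≡ fromℕ (m ℕ.+ n)
fromℕ-homo-+ m n =
  ℚₚ.toℚᵘ-injective (ℚᵘ.≃-trans (ℚₚ.toℚᵘ-homo-+ (fromℕ m) (fromℕ n)) (ℚᵘ.*≡* cross))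
  where
  cross : (+ m ℤ.* + 1 ℤ.+ + n ℤ.* + 1) ℤ.* + 1 ≡ + (m ℕ.+ n) ℤ.* + 1
  cross rewrite ℤ.*-identityʳ (+ m ℤ.* + 1 ℤ.+ + n ℤ.* + 1) | n*1≡n m | n*1≡n n | n*1≡n (m ℕ.+ n) =
    sym (ℤ.pos-+ m n)

i≤+∣i∣ : ∀ i → i ℤ.≤ + ℤ.∣ i ∣
i≤+∣i∣ (+ n)    = ℤ.≤-refl
i≤+∣i∣ -[1+ n ] = -≤+

archimedean : ∀ q → Σ ℕ λ n → q < fromℕ n
archimedean (mkℚ i d _) = suc ℤ.∣ i ∣ , *<* i<[1+∣i∣][1+d]
  where
  i<[1+∣i∣][1+d] : i ℤ.* + 1 ℤ.< + suc ℤ.∣ i ∣ ℤ.* + suc d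
  i<[1+∣i∣][1+d] rewrite ℤ.*-identityʳ i | sym (ℤ.pos-* (suc ℤ.∣ i ∣) (suc d)) =
    ℤ.≤-<-trans (i≤+∣i∣ i) (+<+ (ℕ.m≤m*n (suc ℤ.∣ i ∣) (suc d)))

≤-⇒+≤ : ∀ {l t s} → l ≤ t - s → l + s ≤ t
≤-⇒+≤ {l} {t} {s} p = subst (l + s ≤_) (//-rightDividesˡ ℚₚ.+-0-group s t) (ℚₚ.+-monoˡ-≤ s p)

-≤⇒≤+ : ∀ {u t s} → t - s ≤ u → t ≤ u + s
-≤⇒≤+ {u} {t} {s} p = subst (_≤ u + s) (//-rightDividesˡ ℚₚ.+-0-group s t) (ℚₚ.+-monoˡ-≤ s p)

-<⇒<+ : ∀ {u t s} → t - s < u → t < u + s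
-<⇒<+ {u} {t} {s} p = subst (_< u + s) (//-rightDividesˡ ℚₚ.+-0-group s t) (ℚₚ.+-monoˡ-< s p)

+-‿cancelʳ : ∀ c s → (c + s) - s ≡ c
+-‿cancelʳ c s = //-rightDividesʳ ℚₚ.+-0-group s c

StableFrom : Program → Database → ℚ → Set₁
StableFrom Π D T = ∀ (t : ℚ) → T < t → ∀ (α : GroundAtom) →
  ((α at t ∈⟦ Π , D ⟧ → α at T ∈⟦ Π , D ⟧) × (α at T ∈⟦ Π , D ⟧ → α at t ∈⟦ Π , D ⟧))

Oscillates : Program → Database → GroundAtom → Set₁
Oscillates Π D α = ∀ T → Σ ℚ λ t₁ → Σ ℚ λ t₂ →
  T < t₁ × T < t₂ × α at t₁ ∈⟦ Π , D ⟧ × ¬ (α at t₂ ∈⟦ Π , D ⟧)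

oscillating⇒¬stable : ∀ {Π D} α → Oscillates Π D α → ¬ (Σ ℚ (StableFrom Π D))
oscillating⇒¬stable α osc (T , stable) with osc T
... | t₁ , t₂ , T<t₁ , T<t₂ , α-at-t₁ , ¬α-at-t₂ =
  ¬α-at-t₂ (proj₂ (stable t₂ T<t₂ α) (proj₁ (stable t₁ T<t₁ α) α-at-t₁))

P A B : Atom
P = 0 ⟨ [] ⟩
A = 1 ⟨ [] ⟩
B = 2 ⟨ [] ⟩

Pg : GroundAtom
Pg = 0 ⟪ [] ⟫

[1,2] [2,3⟩ : Interval
[1,2] = ⟨ fin (fromℕ 1) true , fin (fromℕ 2) true ⟩
[2,3⟩ = ⟨ fin (fromℕ 2) true , fin (fromℕ 3) false ⟩

Π₀ : Program
Π₀ = diamond [1,2] P A ∷ diamond [2,3⟩ P B ∷ conj A (B ∷ []) P ∷ []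

D₀ : Database
D₀ = (Pg at ⟨ fin 0ℚ true , fin 0ℚ true ⟩) ∷ []

Π₀-wellFormed : All WellFormedRule Π₀
Π₀-wellFormed =
    ((λ _ ()) , fromℕ-mono-≤ z≤n , fromℕ-mono-< ℕ.≤-refl)
  ∷ ((λ _ ()) , fromℕ-mono-≤ z≤n , fromℕ-mono-< ℕ.≤-refl)
  ∷ (λ _ ())
  ∷ []

2∈[1,2] : fromℕ 2 ∈ᵢ [1,2]
2∈[1,2] = fromℕ-mono-≤ (s≤s z≤n) , ℚₚ.≤-refl

2∈[2,3⟩ : fromℕ 2 ∈ᵢ [2,3⟩
2∈[2,3⟩ = ℚₚ.≤-refl , fromℕ-mono-< ℕ.≤-refl

gap-between-evens : ∀ k → fromℕ (2 ℕ.* suc k) - fromℕ (2 ℕ.* k) ≡ fromℕ 2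
gap-between-evens k = begin
  fromℕ (2 ℕ.* suc k) - fromℕ (2 ℕ.* k)            ≡⟨ cong (λ n → fromℕ n - fromℕ (2 ℕ.* k)) (ℕ.*-suc 2 k) ⟩
  fromℕ (2 ℕ.+ 2 ℕ.* k) - fromℕ (2 ℕ.* k)          ≡⟨ cong (_- fromℕ (2 ℕ.* k)) (fromℕ-homo-+ 2 (2 ℕ.* k)) ⟨
  (fromℕ 2 + fromℕ (2 ℕ.* k)) - fromℕ (2 ℕ.* k)    ≡⟨ +-‿cancelʳ (fromℕ 2) (fromℕ (2 ℕ.* k)) ⟩
  fromℕ 2                                          ∎
  where open ≡-Reasoning

P-at-even : ∀ k → Pg at fromℕ (2 ℕ.* k) ∈⟦ Π₀ , D₀ ⟧
P-at-even zero M _ (P-on-[0,0] ∷ []) = P-on-[0,0] 0ℚ (ℚₚ.≤-refl , ℚₚ.≤-refl)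
P-at-even (suc k) M M⊨Π@(A-rule ∷ B-rule ∷ P-rule ∷ []) M⊨D =
  P-rule σ t (A-rule σ t (s , A-window , P-at-s) ∷ B-rule σ t (s , B-window , P-at-s) ∷ [])
  where
  σ : Subst
  σ _ = 0
  t s : ℚ
  t = fromℕ (2 ℕ.* suc k)
  s = fromℕ (2 ℕ.* k)
  P-at-s : M Pg s
  P-at-s = P-at-even k M M⊨Π M⊨D
  A-window : (t - s) ∈ᵢ [1,2]
  A-window = subst (_∈ᵢ [1,2]) (sym (gap-between-evens k)) 2∈[1,2]
  B-window : (t - s) ∈ᵢ [2,3⟩
  B-window = subst (_∈ᵢ [2,3⟩) (sym (gap-between-evens k)) 2∈[2,3⟩

EvenNat : ℚ → Set
EvenNat t = Σ ℕ λ k → t ≡ fromℕ (2 ℕ.* k)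

evens : Interpretation
evens (0 ⟪ _ ⟫)     t = EvenNat t
evens (1 ⟪ _ ⟫)     t = Σ ℚ λ s → ((t - s) ∈ᵢ [1,2]) × EvenNat s
evens (2 ⟪ _ ⟫)     t = Σ ℚ λ s → ((t - s) ∈ᵢ [2,3⟩) × EvenNat s
evens (suc (suc (suc _)) ⟪ _ ⟫) _ = ⊤

windows-meet-at-even : ∀ {t} a b →
  fromℕ (1 ℕ.+ 2 ℕ.* a) ≤ t → t ≤ fromℕ (2 ℕ.+ 2 ℕ.* a) →
  fromℕ (2 ℕ.+ 2 ℕ.* b) ≤ t → t < fromℕ (3 ℕ.+ 2 ℕ.* b) →
  t ≡ fromℕ (2 ℕ.* suc a)
windows-meet-at-even {t} a b 2a+1≤t t≤2a+2 2b+2≤t t<2b+3 =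
  trans (ℚₚ.≤-antisym t≤2a+2 2a+2≤t) (cong fromℕ (sym (ℕ.*-suc 2 a)))
  where
  b≤a : b ℕ.≤ a
  b≤a = ℕ.*-cancelˡ-≤ 2 (ℕ.+-cancelˡ-≤ 2 _ _ (fromℕ-cancel-≤ (ℚₚ.≤-trans 2b+2≤t t≤2a+2)))
  a<1+b : a ℕ.< suc b
  a<1+b = ℕ.*-cancelˡ-< 2 a (suc b)
    (subst (2 ℕ.* a ℕ.<_) (sym (ℕ.*-suc 2 b))
      (ℕ.+-cancelˡ-< 1 _ _ (fromℕ-cancel-< (ℚₚ.≤-<-trans 2a+1≤t t<2b+3))))
  2a+2≤t : fromℕ (2 ℕ.+ 2 ℕ.* a) ≤ t
  2a+2≤t = subst (λ c → fromℕ (2 ℕ.+ 2 ℕ.* c) ≤ t) (ℕ.≤-antisym b≤a (ℕ.m<1+n⇒m≤n a<1+b)) 2b+2≤t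

shift-lower-bound : ∀ {l t} k → fromℕ l ≤ t - fromℕ k → fromℕ (l ℕ.+ k) ≤ t
shift-lower-bound {l} {t} k p = subst (_≤ t) (fromℕ-homo-+ l k) (≤-⇒+≤ p)

evens-⊨-P-rule : ∀ t → evens (1 ⟪ [] ⟫) t → evens (2 ⟪ [] ⟫) t → EvenNat t
evens-⊨-P-rule t (_ , (lA , uA) , a , refl) (_ , (lB , uB) , b , refl) =
  suc a , windows-meet-at-even a b
    (shift-lower-bound (2 ℕ.* a) lA)
    (subst (t ≤_) (fromℕ-homo-+ 2 (2 ℕ.* a)) (-≤⇒≤+ uA))
    (shift-lower-bound (2 ℕ.* b) lB)
    (subst (t <_) (fromℕ-homo-+ 3 (2 ℕ.* b)) (-<⇒<+ uB))

evens-⊨-Π₀ : ModelΠ evens Π₀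
evens-⊨-Π₀ =
    (λ _ _ A-at-t → A-at-t)
  ∷ (λ _ _ B-at-t → B-at-t)
  ∷ (λ { _ t (A-at-t ∷ B-at-t ∷ []) → evens-⊨-P-rule t A-at-t B-at-t })
  ∷ []

evens-⊨-D₀ : ModelD evens D₀
evens-⊨-D₀ = (λ t (0≤t , t≤0) → 0 , ℚₚ.≤-antisym t≤0 0≤t) ∷ []

¬P-at-odd : ∀ m → ¬ (Pg at fromℕ (1 ℕ.+ 2 ℕ.* m) ∈⟦ Π₀ , D₀ ⟧)
¬P-at-odd m P-at-odd with P-at-odd evens evens-⊨-Π₀ evens-⊨-D₀
... | k , odd≡even = ℕ.even≢odd k m (sym (fromℕ-injective odd≡even))

P-oscillates : Oscillates Π₀ D₀ Pg
P-oscillates T with archimedean T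
... | n , T<n =
  fromℕ (2 ℕ.* n) , fromℕ (1 ℕ.+ 2 ℕ.* n) ,
  ℚₚ.<-≤-trans T<n (fromℕ-mono-≤ n≤2n) ,
  ℚₚ.<-≤-trans T<n (fromℕ-mono-≤ (ℕ.m≤n⇒m≤1+n n≤2n)) ,
  P-at-even n , ¬P-at-odd n
  where
  n≤2n : n ℕ.≤ 2 ℕ.* n
  n≤2n = ℕ.m≤n*m n 2

proposition2 : Σ Database λ D → Σ Program λ Π →
    All WellFormedRule Π ×
    ¬ (Σ ℚ λ T → ∀ (t : ℚ) → T < t → ∀ (α : GroundAtom) →
         ((α at t ∈⟦ Π , D ⟧ → α at T ∈⟦ Π , D ⟧) ×
          (α at T ∈⟦ Π , D ⟧ → α at t ∈⟦ Π , D ⟧)))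
proposition2 = D₀ , Π₀ , Π₀-wellFormed , oscillating⇒¬stable Pg P-oscillates
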